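{- Let $\alpha\geq\omega$ be a countable ordinal and let $\mathcal F$ be an $\alpha$-uniform family on an infinite set $M\subseteq\mathbb N$. Then there are a sequence $(w_j)_j$ of finite sets with $(\min(w_j))_j$ increasing and an increasing sequence of integers $(k_j)_j$ such that $\mathcal F_{w_j}$ is $k_j$-uniform on $M/w_j$ for every $j$.
   Context: Notation: $\max(\emptyset)=-1$; for $A\subseteq\mathbb N$, $A/n=\{m\in A:n<m\}$ and $A/u=A/\max(u)$ for finite $u$. For $\mathcal F\subseteq[\mathbb N]^{<\infty}$ and finite $u$: $\mathcal F_u=\{s: u\cup s\in\mathcal F,\ \max(u)<\min(s)\}$. Uniform families on an infinite $M\subseteq\mathbb N$: $\{\emptyset\}$ is the unique $0$-uniform family on $M$; $\mathcal F$ is $(\beta+1)$-uniform on $M$ if $\mathcal F_{\{n\}}$ is $\beta$-uniform on $M/n$ for all $n\in M$; for limit $\beta$, $\mathcal F$ is $\beta$-uniform on $M$ if there is an increasing sequence of ordinals $(\beta_k)_{k\in M}$ converging to $\beta$ with $\mathcal F_{\{k\}}$ $\beta_k$-uniform on $M/k$ for all $k\in M$. -}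

module Defs where

open import Data.Nat using (ℕ; zero; suc; _<_; _≤_)
open import Data.List using (List; []; _∷_; _++_)
open import Data.List.Relation.Unary.All using (All)
open import Data.List.Relation.Unary.Linked using (Linked)
open import Data.List.Membership.Propositional using (_∈_)
open import Data.Product using (Σ; _×_; ∃)
open import Relation.Binary.PropositionalEquality using (_≡_)

-- Countable ordinals as Brouwer trees, with the (Kraus–Nordvall
-- Forsberg–Xu) inductive order, so that ordinal equality is _≈_.

data Ord : Set where
  ozero : Ord
  osuc  : Ord → Ord
  olim  : (ℕ → Ord) → Ord

infix 4 _≼_ _≺_ _≈_

data _≼_ : Ord → Ord → Set where
  ≼-zero     : ∀ {x} → ozero ≼ x
  ≼-trans    : ∀ {x y z} → x ≼ y → y ≼ z → x ≼ z
  ≼-suc      : ∀ {x y} → x ≼ y → osuc x ≼ osuc y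
  ≼-cocone   : ∀ {x f} k → x ≼ f k → x ≼ olim f
  ≼-limiting : ∀ {x f} → (∀ k → f k ≼ x) → olim f ≼ x

_≺_ : Ord → Ord → Set
x ≺ y = osuc x ≼ y

_≈_ : Ord → Ord → Set
x ≈ y = (x ≼ y) × (y ≼ x)

fin : ℕ → Ord
fin zero    = ozero
fin (suc n) = osuc (fin n)

ω : Ord
ω = olim fin

-- Subsets of ℕ are predicates; finite subsets of ℕ are strictly
-- increasing lists; a family of finite sets is a predicate on lists
-- (only its values on strictly increasing lists matter).

Subset : Set₁
Subset = ℕ → Set

Family : Set₁
Family = List ℕ → Set

FinSet : List ℕ → Set
FinSet = Linked _<_

Infinite : Subset → Set
Infinite M = ∀ n → ∃ λ m → n < m × M m

-- Above u x  ⇔  max(u) < x   (with max(∅) = -1)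
Above : List ℕ → ℕ → Set
Above u x = All (_< x) u

_/_ : Subset → List ℕ → Subset
(M / u) m = M m × Above u m

-- F_u = { s : u ∪ s ∈ F , max(u) < min(s) }
_↾_ : Family → List ℕ → Family
(F ↾ u) s = All (Above u) s × F (u ++ s)

IsMin : ℕ → List ℕ → Set
IsMin m u = m ∈ u × All (m ≤_) u

IsSup : Subset → (ℕ → Ord) → Ord → Set
IsSup M b β = (∀ k → M k → b k ≼ β)
            × (∀ γ → (∀ k → M k → b k ≼ γ) → β ≼ γ)

data Uniform : Subset → Family → Ord → Set₁ where
  uzero : ∀ {M F β} →
          β ≈ ozero →
          F [] →
          (∀ s → FinSet s → F s → s ≡ []) →
          Uniform M F β
  usuc  : ∀ {M F β} (γ : Ord) →
          β ≈ osuc γ →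
          (∀ n → M n → Uniform (M / (n ∷ [])) (F ↾ (n ∷ [])) γ) →
          Uniform M F β
  ulim  : ∀ {M F β} (b : ℕ → Ord) →
          (∀ k l → M k → M l → k < l → b k ≺ b l) →
          IsSup M b β →
          (∀ k → M k → Uniform (M / (k ∷ [])) (F ↾ (k ∷ [])) (b k)) →
          Uniform M F β

module Submission where

-- Call a finite set w ⊆ M a "finite-rank piece above (N, K)"
-- if min w > N and F_w is k-uniform on M/w for some finite k > K.  We show
-- that an α-uniform family with α ≥ ω has such a piece for every N and K;
-- the theorem then follows by choosing pieces one after another, each
-- above the minimum and the rank of the previous one.
--
-- Pieces are found by induction on the derivation of uniformity:
--  * α = γ + 1: pick n ∈ M above N; F_{n} is γ-uniform with γ ≥ ω, so a
--    piece w' of F_{n} gives the piece {n} ∪ w' of F (since (F_{n})_{w'}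
--    = F_{{n} ∪ w'} and (M/n)/w' = M/({n} ∪ w')).
--  * α a limit of (β_k): the β_k increase strictly along M, so some k ∈ M
--    above N has β_k ≥ K + 1; if β_k is finite, {k} itself is a piece,
--    otherwise we recurse into F_{k} as in the successor case.

open import Defs
open import Data.Nat using (ℕ; zero; suc; _<_; _≤_; _+_; z≤n; s≤s)
open import Data.Nat.Properties using (≤-refl; <-trans; ≤-<-trans; <⇒≤; m≤m+n; m≤n+m; n≮n)
open import Data.List using (List; []; _∷_; _++_)
open import Data.List.Relation.Unary.All as All using (All; []; _∷_)
open import Data.List.Relation.Unary.All.Properties using (++⁺; ++⁻ʳ)
open import Data.List.Relation.Unary.Linked using ([-]; _∷_)
open import Data.List.Relation.Unary.Any using (here)
open import Data.Product using (Σ; _×_; _,_; proj₁; proj₂)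
open import Data.Sum using (_⊎_; inj₁; inj₂)
open import Data.Unit using (⊤; tt)
open import Data.Empty using (⊥; ⊥-elim)
open import Relation.Nullary using (¬_)
open import Relation.Binary.PropositionalEquality using (refl)

≼-refl : ∀ x → x ≼ x
≼-refl ozero    = ≼-zero
≼-refl (osuc x) = ≼-suc (≼-refl x)
≼-refl (olim f) = ≼-limiting λ k → ≼-cocone k (≼-refl (f k))

≼-osuc : ∀ x → x ≼ osuc x
≼-osuc ozero    = ≼-zero
≼-osuc (osuc x) = ≼-suc (≼-osuc x)
≼-osuc (olim f) = ≼-limiting λ k →
  ≼-trans (≼-osuc (f k)) (≼-suc (≼-cocone k (≼-refl (f k))))

-- HeightAtMost x m is a structural rendering of "x ≼ fin m".  Being
-- defined by recursion on x, it lets us invert ≼ on finite ordinals,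
-- which the inductive order does not allow directly.
HeightAtMost : Ord → ℕ → Set
HeightAtMost ozero    m       = ⊤
HeightAtMost (osuc x) zero    = ⊥
HeightAtMost (osuc x) (suc m) = HeightAtMost x m
HeightAtMost (olim f) m       = ∀ k → HeightAtMost (f k) m

height-antitone : ∀ {x y} → x ≼ y → ∀ m → HeightAtMost y m → HeightAtMost x m
height-antitone ≼-zero         m       h = tt
height-antitone (≼-trans p q)  m       h = height-antitone p m (height-antitone q m h)
height-antitone (≼-suc p)      zero    ()
height-antitone (≼-suc p)      (suc m) h = height-antitone p m h
height-antitone (≼-cocone k p) m       h = height-antitone p m (h k)
height-antitone (≼-limiting p) m       h = λ k → height-antitone (p k) m h

height-fin : ∀ m → HeightAtMost (fin m) m
height-fin zero    = tt
height-fin (suc m) = height-fin m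

height-fin⇒≤ : ∀ a m → HeightAtMost (fin a) m → a ≤ m
height-fin⇒≤ zero    m       _ = z≤n
height-fin⇒≤ (suc a) zero    ()
height-fin⇒≤ (suc a) (suc m) h = s≤s (height-fin⇒≤ a m h)

fin-≼⇒≤ : ∀ {a m} → fin a ≼ fin m → a ≤ m
fin-≼⇒≤ {a} {m} p = height-fin⇒≤ a m (height-antitone p m (height-fin m))

ω⋠fin : ∀ m → ¬ (ω ≼ fin m)
ω⋠fin m p = n≮n m (fin-≼⇒≤ (≼-trans (≼-cocone (suc m) (≼-refl (fin (suc m)))) p))

infix 4 _≐_

_≐_ : {A : Set} → (A → Set) → (A → Set) → Set
P ≐ Q = (∀ x → P x → Q x) × (∀ x → Q x → P x)

uniform-resp-≈ : ∀ {M F β β'} → β ≈ β' → Uniform M F β → Uniform M F β'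
uniform-resp-≈ (β≼β' , β'≼β) (uzero (β≼0 , _) F∅ F⊆∅) =
  uzero (≼-trans β'≼β β≼0 , ≼-zero) F∅ F⊆∅
uniform-resp-≈ (β≼β' , β'≼β) (usuc γ (β≼γ+1 , γ+1≼β) D) =
  usuc γ (≼-trans β'≼β β≼γ+1 , ≼-trans γ+1≼β β≼β') D
uniform-resp-≈ (β≼β' , β'≼β) (ulim b inc (upper , least) D) =
  ulim b inc ((λ k Mk → ≼-trans (upper k Mk) β≼β') , (λ γ h → ≼-trans β'≼β (least γ h))) D

/-resp-≐ : ∀ {M M' : Subset} u → M ≐ M' → M / u ≐ M' / u
/-resp-≐ u (to , from) = (λ m (Mm , above) → to m Mm , above)
                       , (λ m (Mm , above) → from m Mm , above)

↾-resp-≐ : ∀ {F F' : Family} u → F ≐ F' → F ↾ u ≐ F' ↾ u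
↾-resp-≐ u (to , from) = (λ s (above , Fs) → above , to _ Fs)
                       , (λ s (above , Fs) → above , from _ Fs)

uniform-resp-≐ : ∀ {M M' F F' β} → M ≐ M' → F ≐ F' → Uniform M F β → Uniform M' F' β
uniform-resp-≐ _ (F⊆F' , F'⊆F) (uzero e F∅ F⊆∅) =
  uzero e (F⊆F' [] F∅) (λ s fs F's → F⊆∅ s fs (F'⊆F s F's))
uniform-resp-≐ M≐M' F≐F' (usuc γ e D) =
  usuc γ e λ n M'n → uniform-resp-≐ (/-resp-≐ _ M≐M') (↾-resp-≐ _ F≐F') (D n (proj₂ M≐M' n M'n))
uniform-resp-≐ M≐M'@(M⊆M' , M'⊆M) F≐F' (ulim b inc (upper , least) D) =
  ulim b (λ k l M'k M'l → inc k l (M'⊆M k M'k) (M'⊆M l M'l))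
       ((λ k M'k → upper k (M'⊆M k M'k)) , (λ γ h → least γ (λ k Mk → h k (M⊆M' k Mk))))
       (λ k M'k → uniform-resp-≐ (/-resp-≐ _ M≐M') (↾-resp-≐ _ F≐F') (D k (M'⊆M k M'k)))

/-cons : ∀ (M : Subset) n w → (M / (n ∷ [])) / w ≐ M / (n ∷ w)
/-cons M n w = (λ m ((Mm , n<m) , w<m) → Mm , All.head n<m ∷ w<m)
             , (λ m (Mm , nw<m) → (Mm , All.head nw<m ∷ []) , All.tail nw<m)

↾-cons : ∀ (F : Family) {n w} → All (n <_) w → (F ↾ (n ∷ [])) ↾ w ≐ F ↾ (n ∷ w)
↾-cons F {n} {w} n<w =
    (λ s (w<s , n<ws , Fnws) →
       All.zipWith (λ (n<x , w<x) → All.head n<x ∷ w<x) (++⁻ʳ w n<ws , w<s) , Fnws)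
  , (λ s (nw<s , Fnws) →
       All.map All.tail nw<s ,
       ++⁺ (All.map (_∷ []) n<w) (All.map (λ nw<x → All.head nw<x ∷ []) nw<s) , Fnws)

infinite-/ : ∀ {M} → Infinite M → ∀ n → Infinite (M / (n ∷ []))
infinite-/ inf n x with inf (x + n)
... | m , x+n<m , Mm = m , ≤-<-trans (m≤m+n x n) x+n<m , Mm , ≤-<-trans (m≤n+m n x) x+n<m ∷ []

climb : ∀ {M : Subset} (b : ℕ → Ord) → (∀ k l → M k → M l → k < l → b k ≺ b l) →
        Infinite M → ∀ K N → Σ ℕ λ k → M k × N < k × fin K ≼ b k
climb b inc inf zero N with inf N
... | k , N<k , Mk = k , Mk , N<k , ≼-zero
climb b inc inf (suc K) N with climb b inc inf K N
... | k , Mk , N<k , K≼bk with inf k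
... | l , k<l , Ml = l , Ml , <-trans N<k k<l , ≼-trans (≼-suc K≼bk) (inc k l Mk Ml k<l)

finite-or-transfinite : ∀ {M F β} → Uniform M F β → Infinite M →
                        (Σ ℕ λ m → β ≈ fin m) ⊎ (ω ≼ β)
finite-or-transfinite (uzero e _ _) inf = inj₁ (0 , e)
finite-or-transfinite (usuc γ (β≼γ+1 , γ+1≼β) D) inf with inf 0
... | n , _ , Mn with finite-or-transfinite (D n Mn) (infinite-/ inf n)
... | inj₁ (m , (γ≼m , m≼γ)) = inj₁ (suc m , ≼-trans β≼γ+1 (≼-suc γ≼m) , ≼-trans (≼-suc m≼γ) γ+1≼β)
... | inj₂ ω≼γ = inj₂ (≼-trans ω≼γ (≼-trans (≼-osuc γ) γ+1≼β))
finite-or-transfinite {β = β} (ulim b inc (upper , _) D) inf = inj₂ (≼-limiting fin≼β)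
  where
  fin≼β : ∀ K → fin K ≼ β
  fin≼β K with climb b inc inf K 0
  ... | k , Mk , _ , K≼bk = ≼-trans K≼bk (upper k Mk)

record Piece (M : Subset) (F : Family) (N K : ℕ) : Set₁ where
  field
    w          : List ℕ
    μ          : ℕ
    k          : ℕ
    finite     : FinSet w
    inM        : All M w
    isMin      : IsMin μ w
    min-above  : N < μ
    rank-above : K < k
    uniform    : Uniform (M / w) (F ↾ w) (fin k)

singleton-piece : ∀ {M F N K n m} → M n → N < n → K < m →
                  Uniform (M / (n ∷ [])) (F ↾ (n ∷ [])) (fin m) → Piece M F N K
singleton-piece {n = n} {m} Mn N<n K<m U = record
  { w = n ∷ [] ; μ = n ; k = m ; finite = [-] ; inM = Mn ∷ []
  ; isMin = here refl , ≤-refl ∷ [] ; min-above = N<n ; rank-above = K<m ; uniform = U }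

extend-piece : ∀ {M F N K n} → M n → N < n →
               Piece (M / (n ∷ [])) (F ↾ (n ∷ [])) 0 K → Piece M F N K
extend-piece {M} {F} {n = n} Mn N<n p = record
  { w = n ∷ w ; μ = n ; k = k
  ; finite = n<w⇒linked n<w finite
  ; inM = Mn ∷ All.map proj₁ inM
  ; isMin = here refl , ≤-refl ∷ All.map <⇒≤ n<w
  ; min-above = N<n ; rank-above = rank-above
  ; uniform = uniform-resp-≐ (/-cons M n w) (↾-cons F n<w) uniform }
  where
  open Piece p
  n<w : All (n <_) w
  n<w = All.map (λ (_ , n<x) → All.head n<x) inM
  n<w⇒linked : ∀ {v} → All (n <_) v → FinSet v → FinSet (n ∷ v)
  n<w⇒linked []        _  = [-]
  n<w⇒linked (n<x ∷ _) fs = n<x ∷ fs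

piece : ∀ {M F β} → Uniform M F β → Infinite M → ω ≼ β → ∀ N K → Piece M F N K
piece (uzero (β≼0 , _) _ _) inf ω≼β N K = ⊥-elim (ω⋠fin 0 (≼-trans ω≼β β≼0))
piece (usuc γ (β≼γ+1 , _) D) inf ω≼β N K with inf N
... | n , N<n , Mn with finite-or-transfinite (D n Mn) (infinite-/ inf n)
... | inj₁ (m , (γ≼m , _)) = ⊥-elim (ω⋠fin (suc m) (≼-trans ω≼β (≼-trans β≼γ+1 (≼-suc γ≼m))))
... | inj₂ ω≼γ = extend-piece Mn N<n (piece (D n Mn) (infinite-/ inf n) ω≼γ 0 K)
piece (ulim b inc _ D) inf ω≼β N K with climb b inc inf (suc K) N
... | k , Mk , N<k , K+1≼bk with finite-or-transfinite (D k Mk) (infinite-/ inf k)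
... | inj₁ (m , bk≈m) =
  singleton-piece Mk N<k (fin-≼⇒≤ (≼-trans K+1≼bk (proj₁ bk≈m))) (uniform-resp-≈ bk≈m (D k Mk))
... | inj₂ ω≼bk = extend-piece Mk N<k (piece (D k Mk) (infinite-/ inf k) ω≼bk 0 K)

piece-chain : ∀ {M F} → (∀ N K → Piece M F N K) → ℕ → Σ ℕ λ N → Σ ℕ λ K → Piece M F N K
piece-chain pieces zero    = 0 , 0 , pieces 0 0
piece-chain pieces (suc j) = Piece.μ p , Piece.k p , pieces (Piece.μ p) (Piece.k p)
  where p = proj₂ (proj₂ (piece-chain pieces j))

mainTheorem14 : (α : Ord) → ω ≼ α →
    (M : Subset) → Infinite M →
    (F : Family) → Uniform M F α →
    Σ (ℕ → List ℕ) λ w → Σ (ℕ → ℕ) λ μ → Σ (ℕ → ℕ) λ k →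
    (∀ j → FinSet (w j))
    × (∀ j → IsMin (μ j) (w j))
    × (∀ j → μ j < μ (suc j))
    × (∀ j → k j < k (suc j))
    × (∀ j → Uniform (M / w j) (F ↾ w j) (fin (k j)))
mainTheorem14 α ω≼α M inf F U =
    (λ j → w (P j)) , (λ j → μ (P j)) , (λ j → k (P j))
  , (λ j → finite (P j)) , (λ j → isMin (P j))
  , (λ j → min-above (P (suc j))) , (λ j → rank-above (P (suc j)))
  , (λ j → uniform (P j))
  where
  open Piece
  P : ∀ j → Piece M F _ _
  P j = proj₂ (proj₂ (piece-chain (piece U inf ω≼α) j))
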